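{- Let $n\ge1$, let $\lambda=n^2$ be the two-row shape with both rows of length $n$, and let $\rho$ be a density with $\rho_{1,j}=a_j>0$ and $\rho_{2,j}=b_j>0$ for all $j$; put $a=\sum_j a_j$, $b=\sum_j b_j$. Let $P_1,P_2$ be N-E lattice paths of shape $(a,b)$ with $P_1\ge P_2$. If $P_1$ lies in the image of $\psi_\rho$, then $P_2$ lies in the image of $\psi_\rho$.
   Context: Cell $(i,j)$ is in row $i$, column $j$. A standard set-valued Young tableau of shape $\lambda$ and density $\rho$ is an assignment to each cell $(i,j)$ of a set of exactly $\rho_{i,j}$ integers, these sets partitioning $\{1,\dots,a+b\}$, such that every integer in cell $(i,j)$ is smaller than every integer in cells $(i,j+1)$ and $(i+1,j)$ when these exist; $\mathrm{SVT}(\lambda,\rho)$ is the set of such tableaux. An N-E lattice path of shape $(a,b)$ is a lattice path from $(0,0)$ to $(a,b)$ using steps $E=(1,0)$ and $N=(0,1)$; $\mathcal{P}$ denotes the set of these. For $P_1,P_2\in\mathcal{P}$, $P_1\ge P_2$ means $P_1$ lies weakly above $P_2$ over $0\le x\le a$. The map $\psi_\rho:\mathrm{SVT}(\lambda,\rho)\to\mathcal{P}$ sends $T$ to the path whose $\ell$-th step ($1\le\ell\le a+b$) is $E$ if $\ell$ lies in the first row of $T$ and $N$ if $\ell$ lies in the second row of $T$. -}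

module Defs where

open import Data.Nat using (ℕ; zero; suc; _+_; _<_; _≥_; _≤_)
open import Data.Fin using (Fin; toℕ) renaming (zero to fzero; suc to fsuc)
open import Data.Fin.Properties using () renaming (_≟_ to _≟ᶠ_)
open import Data.Product using (Σ; ∃; _×_; _,_; proj₁)
open import Data.Product.Properties using (≡-dec)
open import Data.Vec using (Vec; lookup; tabulate; toList; sum)
open import Data.List using (List; []; _∷_; length; filter; take)
open import Data.List.Base using (allFin)
open import Relation.Binary.PropositionalEquality using (_≡_)
open import Relation.Nullary using (Dec; yes; no)

Cell : ℕ → Set
Cell n = Fin 2 × Fin n

_≟ᶜ_ : ∀ {n} (c d : Cell n) → Dec (c ≡ d)
_≟ᶜ_ = ≡-dec _≟ᶠ_ _≟ᶠ_

ρ : ∀ {n} → Vec ℕ n → Vec ℕ n → Cell n → ℕ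
ρ a b (fzero , j) = lookup a j
ρ a b (fsuc _ , j) = lookup b j

fiberSize : ∀ {N n} → (Fin N → Cell n) → Cell n → ℕ
fiberSize {N} f c = length (filter (λ x → f x ≟ᶜ c) (allFin N))

-- The integers 1..a+b are represented by Fin (a+b) (label ℓ ↦ integer ℓ+1);
-- the tableau is recorded as the map sending each integer to the (unique) cell
-- containing it, so the cell sets automatically partition {1,…,a+b}.
record SVT (n : ℕ) (a b : Vec ℕ n) : Set where
  field
    cell    : Fin (sum a + sum b) → Cell n
    size    : ∀ c → fiberSize cell c ≡ ρ a b c
    rowIncr : ∀ (i : Fin 2) (j j' : Fin n) (x y : Fin (sum a + sum b)) →
              toℕ j' ≡ suc (toℕ j) → cell x ≡ (i , j) → cell y ≡ (i , j') →
              toℕ x < toℕ y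
    colIncr : ∀ (j : Fin n) (x y : Fin (sum a + sum b)) →
              cell x ≡ (fzero , j) → cell y ≡ (fsuc fzero , j) →
              toℕ x < toℕ y

data Step : Set where
  E N : Step

isE : Step → ℕ
isE E = 1
isE N = 0

isN : Step → ℕ
isN E = 0
isN N = 1

countE countN : List Step → ℕ
countE [] = 0
countE (s ∷ ss) = isE s + countE ss
countN [] = 0
countN (s ∷ ss) = isN s + countN ss

record Path (a b : ℕ) : Set where
  constructor path
  field
    steps : Vec Step (a + b)
    shape : countE (toList steps) ≡ a
open Path public

_≥ᴾ_ : ∀ {a b} → Path a b → Path a b → Set
P₁ ≥ᴾ P₂ = ∀ (k : ℕ) → countN (take k (toList (steps P₁))) ≥ countN (take k (toList (steps P₂)))

rowStep : ∀ {n} → Cell n → Step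
rowStep (fzero , _) = E
rowStep (fsuc _ , _) = N

ψ : ∀ {n} {a b : Vec ℕ n} → SVT n a b → Vec Step (sum a + sum b)
ψ T = tabulate (λ ℓ → rowStep (SVT.cell T ℓ))

InImageψ : ∀ {n} (a b : Vec ℕ n) → Path (sum a) (sum b) → Set
InImageψ {n} a b P = Σ (SVT n a b) (λ T → ψ T ≡ steps P)

module Submission where

-- Recording for each label the cell containing it, a tableau is the same thing as a word in the
-- cells that contains each cell ρ times and is a linear extension of the cell order; ψ reads off
-- the rows of its letters. A second-row cell is never below a first-row cell, so exchanging a
-- second-row letter with a first-row letter right after it yields again a tableau word, and on
-- paths it replaces a corner NE by EN. Every path weakly below P₁ arises from P₁ by such exchanges:
-- scan P₂ step by step, and whenever it takes an E-step where the word shows N-letters, move the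
-- next E-letter of the word forward past them; since P₁ lies above P₂, the word always has an
-- N-letter available when P₂ takes an N-step.

open import Defs
open import Data.Bool using (true; false)
open import Data.Empty using (⊥-elim)
open import Data.Nat using (ℕ; zero; suc; _+_; _≥_; _>_; _<_; _≤_; s≤s⁻¹; s≤s; z≤n)
open import Data.Nat.Properties using (+-suc; +-comm; 1+n≢n; <-asym; suc-injective)
open import Data.Fin using (Fin; toℕ) renaming (zero to fzero; suc to fsuc)
open import Data.Product using (Σ; ∃-syntax; _×_; _,_)
open import Data.Vec as Vec using (Vec; sum)
open import Data.Vec.Properties using (toList-injective; length-toList; cast-is-id)
open import Data.Vec.Relation.Unary.All using (All)
open import Data.List using (List; []; _∷_; _++_; _∷ʳ_; length; filter; take; map; tabulate; allFin)
open import Data.List.Properties using (length-tabulate; map-tabulate; length-++; length-++-sucʳ; ∷ʳ-++)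
open import Data.List.Relation.Unary.All as ListAll using ([]; _∷_)
open import Data.List.Relation.Unary.All.Properties using (++⁺; tabulate⁻)
open import Data.List.Relation.Unary.AllPairs using (AllPairs; _∷_)
open import Data.List.Relation.Unary.AllPairs.Properties using (tabulate⁺-<)
open import Data.List.Relation.Binary.Permutation.Propositional using (_↭_; prep; swap; ↭-refl; ↭-trans)
open import Data.List.Relation.Binary.Permutation.Propositional.Properties using (All-resp-↭; filter-↭; ↭-length)
open import Relation.Binary.Construct.Closure.ReflexiveTransitive using (Star; ε; _◅_; _◅◅_; gmap)
open import Relation.Binary.PropositionalEquality
open import Relation.Nullary using (¬_; does)
open import Relation.Unary using (Decidable)
open import Function using (_∘_; id)

module _ {A B : Set} where

  length-filter-map : ∀ {P : B → Set} (P? : Decidable P) (f : A → B) xs →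
                      length (filter P? (map f xs)) ≡ length (filter (P? ∘ f) xs)
  length-filter-map P? f [] = refl
  length-filter-map P? f (x ∷ xs) with does (P? (f x))
  ... | true  = cong suc (length-filter-map P? f xs)
  ... | false = length-filter-map P? f xs

module _ {A : Set} where

  tabulate-surjective : ∀ {m} (xs : List A) → length xs ≡ m → ∃[ f ] tabulate {n = m} f ≡ xs
  tabulate-surjective []       refl = (λ ()) , refl
  tabulate-surjective (x ∷ xs) refl =
    let f , f≡xs = tabulate-surjective xs refl
    in (λ { fzero → x ; (fsuc i) → f i }) , cong (x ∷_) f≡xs

  toList-tabulate : ∀ {m} (f : Fin m → A) → Vec.toList (Vec.tabulate f) ≡ tabulate f
  toList-tabulate {zero}  f = refl
  toList-tabulate {suc m} f = cong (f fzero ∷_) (toList-tabulate (f ∘ fsuc))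

  toList-injective-≡ : ∀ {m} (xs ys : Vec A m) → Vec.toList xs ≡ Vec.toList ys → xs ≡ ys
  toList-injective-≡ xs ys eq = trans (sym (cast-is-id refl xs)) (toList-injective refl xs ys eq)

module _ {A : Set} where

  data AdjacentSwap (R : A → A → Set) : List A → List A → Set where
    here  : ∀ {x y zs} → R x y → AdjacentSwap R (x ∷ y ∷ zs) (y ∷ x ∷ zs)
    there : ∀ {x ys zs} → AdjacentSwap R ys zs → AdjacentSwap R (x ∷ ys) (x ∷ zs)

  module _ {R : A → A → Set} where

    AdjacentSwap⇒↭ : ∀ {xs ys} → AdjacentSwap R xs ys → xs ↭ ys
    AdjacentSwap⇒↭ (here _)  = swap _ _ ↭-refl
    AdjacentSwap⇒↭ (there s) = prep _ (AdjacentSwap⇒↭ s)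

    swaps⇒↭ : ∀ {xs ys} → Star (AdjacentSwap R) xs ys → xs ↭ ys
    swaps⇒↭ ε        = ↭-refl
    swaps⇒↭ (s ◅ ss) = ↭-trans (AdjacentSwap⇒↭ s) (swaps⇒↭ ss)

    AllPairs-swap : ∀ {Q : A → A → Set} → (∀ {x y} → R x y → Q y x) →
                    ∀ {xs ys} → AdjacentSwap R xs ys → AllPairs Q xs → AllPairs Q ys
    AllPairs-swap R⇒Q (here rxy) ((_ ∷ qxzs) ∷ qyzs ∷ qzs) = (R⇒Q rxy ∷ qyzs) ∷ qxzs ∷ qzs
    AllPairs-swap R⇒Q (there s)  (qxys ∷ qys) =
      All-resp-↭ (AdjacentSwap⇒↭ s) qxys ∷ AllPairs-swap R⇒Q s qys

    AllPairs-swaps : ∀ {Q : A → A → Set} → (∀ {x y} → R x y → Q y x) →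
                     ∀ {xs ys} → Star (AdjacentSwap R) xs ys → AllPairs Q xs → AllPairs Q ys
    AllPairs-swaps R⇒Q ε        = id
    AllPairs-swaps R⇒Q (s ◅ ss) = AllPairs-swaps R⇒Q ss ∘ AllPairs-swap R⇒Q s

    bubble : ∀ {y} xs zs → ListAll.All (λ x → R x y) xs →
             Star (AdjacentSwap R) (xs ++ y ∷ zs) (y ∷ xs ++ zs)
    bubble []       zs []           = ε
    bubble (x ∷ xs) zs (rxy ∷ rs) = gmap (x ∷_) there (bubble xs zs rs) ◅◅ (here rxy ◅ ε)

-- `Above h u v`: the path u, preceded by h extra N-steps, lies weakly above v.
Above : ℕ → List Step → List Step → Set
Above h u v = ∀ r → countN (take (h + r) v) ≤ h + countN (take r u)

module _ {h : ℕ} {u v : List Step} where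

  Above-E∷ : Above h (E ∷ u) (E ∷ v) → Above h u v
  Above-E∷ above r =
    subst (λ k → countN (take k (E ∷ v)) ≤ h + countN (take r u)) (+-suc h r) (above (suc r))

  Above-release : Above (suc h) u (N ∷ v) → Above h u v
  Above-release above r = s≤s⁻¹ (above r)

  Above-postpone : Above h (N ∷ u) (E ∷ v) → Above (suc h) u (E ∷ v)
  Above-postpone above r =
    subst₂ (λ k l → countN (take k (E ∷ v)) ≤ l) (+-suc h r) (+-suc h _) (above (suc r))

Above₀-N∷ : ∀ {u v} → Above 0 (N ∷ u) (N ∷ v) → Above 0 u v
Above₀-N∷ above r = s≤s⁻¹ (above (suc r))

module _ {A : Set} (s : A → Step) where

  Lowers : A → A → Set
  Lowers x y = s x ≡ N × s y ≡ E

  LowersTo : List A → List Step → Set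
  LowersTo w v = ∃[ w′ ] Star (AdjacentSwap Lowers) w w′ × map s w′ ≡ v

  LowersTo-∷ : ∀ {x t w v} → s x ≡ t → LowersTo w v → LowersTo (x ∷ w) (t ∷ v)
  LowersTo-∷ {x} sx (w′ , w↝w′ , w′≡v) = x ∷ w′ , gmap (x ∷_) there w↝w′ , cong₂ _∷_ sx w′≡v

  LowersTo-◅◅ : ∀ {w w′ v} → Star (AdjacentSwap Lowers) w w′ → LowersTo w′ v → LowersTo w v
  LowersTo-◅◅ w↝w′ (w″ , w′↝w″ , w″≡v) = w″ , w↝w′ ◅◅ w′↝w″ , w″≡v

  -- K holds N-letters of the word already passed over by v; each is moved behind the next E-letter.
  lower : ∀ v K w → ListAll.All (λ x → s x ≡ N) K → Above (length K) (map s w) v →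
          length (K ++ w) ≡ length v → countE (map s w) ≡ countE v → LowersTo (K ++ w) v
  lower []      []      []      _        _     _   _  = [] , ε , refl
  lower []      []      (_ ∷ _) _        _     ()  _
  lower []      (_ ∷ _) _       _        _     ()  _
  lower (N ∷ v) (k ∷ K) w       (sk ∷ K-N) above len ce =
    LowersTo-∷ sk (lower v K w K-N (Above-release above) (suc-injective len) ce)
  lower (N ∷ v) []      []      _        _     ()  _
  lower (N ∷ v) []      (x ∷ w) []       above len ce with s x in sx
  ... | N = LowersTo-∷ sx (lower v [] w [] (Above₀-N∷ above) (suc-injective len) ce)
  ... | E with above 1
  ...   | ()
  lower (E ∷ v) K       []      _        _     _   ()
  lower (E ∷ v) K       (x ∷ w) K-N      above len ce with s x in sx
  ... | E = LowersTo-◅◅ (bubble K w (ListAll.map (_, sx) K-N))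
              (LowersTo-∷ sx (lower v K w K-N (Above-E∷ above)
                (suc-injective (trans (sym (length-++-sucʳ K x w)) len)) (suc-injective ce)))
  ... | N =
    subst (λ z → LowersTo z (E ∷ v)) (∷ʳ-++ K x w)
      (lower (E ∷ v) (K ∷ʳ x) w (++⁺ K-N (sx ∷ []))
        (subst (λ h → Above h (map s w) (E ∷ v)) (sym (length-∷ʳ K)) (Above-postpone above))
        (trans (cong length (∷ʳ-++ K x w)) len) ce)
    where
    length-∷ʳ : ∀ ys → length (ys ∷ʳ x) ≡ suc (length ys)
    length-∷ʳ ys = trans (length-++ ys) (+-comm (length ys) 1)

module _ {A : Set} where

  LinearExtension : (A → A → Set) → List A → Set
  LinearExtension _≺_ = AllPairs (λ x y → ¬ y ≺ x)

  module _ {_≺_ : A → A → Set} where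

    monotone⇒linearExtension : ∀ {m} {f : Fin m → A} → (∀ {x y} → f x ≺ f y → toℕ x < toℕ y) →
                               LinearExtension _≺_ (tabulate f)
    monotone⇒linearExtension mono = tabulate⁺-< (λ x<y fy≺fx → <-asym x<y (mono fy≺fx))

    linearExtension⇒monotone : (∀ {x} → ¬ x ≺ x) →
                               ∀ {m} {f : Fin m → A} → LinearExtension _≺_ (tabulate f) →
                               ∀ {x y} → f x ≺ f y → toℕ x < toℕ y
    linearExtension⇒monotone irrefl _           {fzero}  {fzero}  fx≺fy = ⊥-elim (irrefl fx≺fy)
    linearExtension⇒monotone irrefl _           {fzero}  {fsuc y} fx≺fy = s≤s z≤n
    linearExtension⇒monotone irrefl (first ∷ _) {fsuc x} {fzero}  fx≺fy = ⊥-elim (tabulate⁻ first x fx≺fy)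
    linearExtension⇒monotone irrefl (_ ∷ rest)  {fsuc x} {fsuc y} fx≺fy =
      s≤s (linearExtension⇒monotone irrefl rest fx≺fy)

module _ {n : ℕ} where

  data _⋖_ : Cell n → Cell n → Set where
    right : ∀ {i j j′} → toℕ j′ ≡ suc (toℕ j) → (i , j) ⋖ (i , j′)
    down  : ∀ {j} → (fzero , j) ⋖ (fsuc fzero , j)

  ⋖-irrefl : ∀ {c} → ¬ c ⋖ c
  ⋖-irrefl (right e) = 1+n≢n (sym e)

  Lowers⇒¬⋖ : ∀ {c d} → Lowers rowStep c d → ¬ c ⋖ d
  Lowers⇒¬⋖ {fzero  , _} (() , _) (right _)
  Lowers⇒¬⋖ {fsuc _ , _} (_ , ()) (right _)
  Lowers⇒¬⋖              (() , _) down

  occurrences : Cell n → List (Cell n) → ℕ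
  occurrences c = length ∘ filter (_≟ᶜ c)

  fiberSize-tabulate : ∀ {m} (f : Fin m → Cell n) c → fiberSize f c ≡ occurrences c (tabulate f)
  fiberSize-tabulate f c =
    trans (sym (length-filter-map (_≟ᶜ c) f (allFin _))) (cong (occurrences c) (map-tabulate id f))

module _ {n : ℕ} {a b : Vec ℕ n} where

  readingWord : SVT n a b → List (Cell n)
  readingWord T = tabulate (SVT.cell T)

  readingWord-linear : (T : SVT n a b) → LinearExtension _⋖_ (readingWord T)
  readingWord-linear T = monotone⇒linearExtension (increasing refl refl)
    where
    open SVT T
    increasing : ∀ {x y c d} → cell x ≡ c → cell y ≡ d → c ⋖ d → toℕ x < toℕ y
    increasing ex ey (right e) = rowIncr _ _ _ _ _ e ex ey
    increasing ex ey down      = colIncr _ _ _ ex ey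

  readingWord-occurrences : (T : SVT n a b) → ∀ c → occurrences c (readingWord T) ≡ ρ a b c
  readingWord-occurrences T c = trans (sym (fiberSize-tabulate (SVT.cell T) c)) (SVT.size T c)

  ψ-readingWord : (T : SVT n a b) → Vec.toList (ψ T) ≡ map rowStep (readingWord T)
  ψ-readingWord T =
    trans (toList-tabulate (rowStep ∘ SVT.cell T)) (sym (map-tabulate (SVT.cell T) rowStep))

  tabulationTableau : (f : Fin (sum a + sum b) → Cell n) → LinearExtension _⋖_ (tabulate f) →
                      (∀ c → occurrences c (tabulate f) ≡ ρ a b c) → SVT n a b
  tabulationTableau f lin occ = record
    { cell    = f
    ; size    = λ c → trans (fiberSize-tabulate f c) (occ c)
    ; rowIncr = λ _ _ _ _ _ e ex ey → increasing (subst₂ _⋖_ (sym ex) (sym ey) (right e))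
    ; colIncr = λ _ _ _ ex ey → increasing (subst₂ _⋖_ (sym ex) (sym ey) down)
    }
    where
    increasing : ∀ {x y} → f x ⋖ f y → toℕ x < toℕ y
    increasing = linearExtension⇒monotone ⋖-irrefl lin

  wordTableau : (w : List (Cell n)) → length w ≡ sum a + sum b → LinearExtension _⋖_ w →
                (∀ c → occurrences c w ≡ ρ a b c) → Σ (SVT n a b) (λ T → readingWord T ≡ w)
  wordTableau w len lin occ with tabulate-surjective w len
  ... | f , refl = tabulationTableau f lin occ , refl

  swapsTableau : (T : SVT n a b) {w : List (Cell n)} →
                 Star (AdjacentSwap (Lowers rowStep)) (readingWord T) w →
                 Σ (SVT n a b) (λ T′ → readingWord T′ ≡ w)
  swapsTableau T {w} T↝w = wordTableau w len lin occ
    where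
    T↭w : readingWord T ↭ w
    T↭w = swaps⇒↭ T↝w
    len : length w ≡ sum a + sum b
    len = trans (sym (↭-length T↭w)) (length-tabulate _)
    lin : LinearExtension _⋖_ w
    lin = AllPairs-swaps Lowers⇒¬⋖ T↝w (readingWord-linear T)
    occ : ∀ c → occurrences c w ≡ ρ a b c
    occ c = trans (sym (↭-length (filter-↭ (_≟ᶜ c) T↭w))) (readingWord-occurrences T c)

  lowerTableau : (T : SVT n a b) (v : Vec Step (sum a + sum b)) →
                 LowersTo rowStep (readingWord T) (Vec.toList v) → Σ (SVT n a b) (λ T′ → ψ T′ ≡ v)
  lowerTableau T v (w , T↝w , w≡v) with swapsTableau T T↝w
  ... | T′ , refl = T′ , toList-injective-≡ (ψ T′) v (trans (ψ-readingWord T′) w≡v)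

lemma4p1 : (n : ℕ) → n ≥ 1 → (a b : Vec ℕ n) → All (_> 0) a → All (_> 0) b →
           (P₁ P₂ : Path (sum a) (sum b)) → P₁ ≥ᴾ P₂ →
           InImageψ a b P₁ → InImageψ a b P₂
lemma4p1 _ _ a b _ _ P₁ P₂ P₁≥P₂ (T₁ , ψT₁≡P₁) =
  lowerTableau T₁ (steps P₂) (lower rowStep u₂ [] w₁ [] w₁-above sameLength sameEs)
  where
  w₁ : List (Cell _)
  w₁ = readingWord T₁
  u₂ : List Step
  u₂ = Vec.toList (steps P₂)
  w₁≡P₁ : map rowStep w₁ ≡ Vec.toList (steps P₁)
  w₁≡P₁ = trans (sym (ψ-readingWord T₁)) (cong Vec.toList ψT₁≡P₁)
  w₁-above : Above 0 (map rowStep w₁) u₂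
  w₁-above = subst (λ u → Above 0 u u₂) (sym w₁≡P₁) P₁≥P₂
  sameLength : length w₁ ≡ length u₂
  sameLength = trans (length-tabulate _) (sym (length-toList (steps P₂)))
  sameEs : countE (map rowStep w₁) ≡ countE u₂
  sameEs = trans (cong countE w₁≡P₁) (trans (shape P₁) (sym (shape P₂)))
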